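{- Let $p_1,\dots,p_m$ be a proper pin sequence in the plot of a permutation. Then for every $i\ge 3$ with $i+1\le m$, the pin $p_{i+1}$ does not have the same direction as $p_i$, nor the opposite direction (left/right and up/down being opposite).
   Context: The plot of a permutation $\pi$ of $[n]$ is the point set $\{(i,\pi(i)):i\in[n]\}$. For points $q_1,\dots,q_m$ in the plane, $\operatorname{rect}(q_1,\dots,q_m)$ denotes the smallest closed axes-parallel rectangle containing them. A pin sequence is a sequence of distinct points $p_1,p_2,\dots,p_m$ of the plot such that for each $i\ge 3$, writing $\operatorname{rect}(p_1,\dots,p_{i-1})=[a,b]\times[c,d]$ and $p_i=(x,y)$: $p_i\notin\operatorname{rect}(p_1,\dots,p_{i-1})$ and either $a<x<b$ or $c<y<d$ ($p_i$ slices the rectangle). Such $p_i$ is a left pin if $x<a$, right pin if $x>b$, up pin if $y>d$, down pin if $y<c$. The pin sequence is proper if (maximality) each $p_i$, $i\ge3$, is extreme in its direction among all points of the plot that could serve as a pin of that direction for $\operatorname{rect}(p_1,\dots,p_{i-1})$ (e.g. if $p_i=(x,y)$ is a right pin, there is no point of the plot in $(x,n]\times[c,d]$, and analogously for the other directions), and (separation) for each $i\ge2$ with $i+1\le m$, $p_{i+1}$ separates $p_i$ from $\operatorname{rect}(p_1,\dots,p_{i-1})$, i.e. $p_{i+1}$ lies horizontally or vertically strictly between $\operatorname{rect}(p_1,\dots,p_{i-1})$ and $p_i$ (the vertical line or the horizontal line through $p_{i+1}$ strictly separates them). -}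

module Defs where

open import Data.Nat using (ℕ; zero; suc; _≤_; _<_; _⊓_; _⊔_)
open import Data.Fin using (Fin; toℕ)
open import Data.Fin.Permutation using (Permutation′; _⟨$⟩ʳ_)
open import Data.Product using (_×_; _,_; ∃; proj₁; proj₂)
open import Data.Sum using (_⊎_)
open import Data.Empty using (⊥)
open import Relation.Nullary using (¬_)
open import Relation.Binary.PropositionalEquality using (_≡_; _≢_)

Point : Set
Point = ℕ × ℕ

-- The plot of a permutation π of [n] = {1,…,n}: points (i, π(i)), 1-indexed.
InPlot : ∀ {n} → Permutation′ n → Point → Set
InPlot {n} π q = ∃ λ (j : Fin n) → q ≡ (suc (toℕ j) , suc (toℕ (π ⟨$⟩ʳ j)))

-- Closed axis-parallel rectangle [a,b] × [c,d].
record Rect : Set where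
  constructor rect
  field
    a b c d : ℕ
open Rect public

pointRect : Point → Rect
pointRect (x , y) = rect x x y y

extend : Rect → Point → Rect
extend (rect a b c d) (x , y) = rect (a ⊓ x) (b ⊔ x) (c ⊓ y) (d ⊔ y)

-- Sequences p₁, p₂, … are functions ℕ → Point (index 0 unused).
-- R p k = rect(p₁,…,p_k) for k ≥ 1 (R p 0 is a junk value, never used).
R : (ℕ → Point) → ℕ → Rect
R p zero = pointRect (p 1)
R p (suc zero) = pointRect (p 1)
R p (suc (suc k)) = extend (R p (suc k)) (p (suc (suc k)))

InRect : Rect → Point → Set
InRect (rect a b c d) (x , y) = (a ≤ x × x ≤ b) × (c ≤ y × y ≤ d)

Slices : Rect → Point → Set
Slices (rect a b c d) (x , y) = (a < x × x < b) ⊎ (c < y × y < d)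

IsPin : Rect → Point → Set
IsPin r q = ¬ InRect r q × Slices r q

data Dir : Set where
  left right up down : Dir

opposite : Dir → Dir
opposite left = right
opposite right = left
opposite up = down
opposite down = up

HasDir : Dir → Rect → Point → Set
HasDir left (rect a b c d) (x , y) = x < a
HasDir right (rect a b c d) (x , y) = b < x
HasDir up (rect a b c d) (x , y) = d < y
HasDir down (rect a b c d) (x , y) = y < c

Extreme : ∀ {n} → Permutation′ n → Dir → Rect → Point → Set
Extreme π right (rect a b c d) (x , y) =
  ∀ q → InPlot π q → x < proj₁ q → c ≤ proj₂ q → proj₂ q ≤ d → ⊥
Extreme π left (rect a b c d) (x , y) =
  ∀ q → InPlot π q → proj₁ q < x → c ≤ proj₂ q → proj₂ q ≤ d → ⊥
Extreme π up (rect a b c d) (x , y) =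
  ∀ q → InPlot π q → y < proj₂ q → a ≤ proj₁ q → proj₁ q ≤ b → ⊥
Extreme π down (rect a b c d) (x , y) =
  ∀ q → InPlot π q → proj₂ q < y → a ≤ proj₁ q → proj₁ q ≤ b → ⊥

Separates : Rect → Point → Point → Set
Separates (rect a b c d) (x , y) (x' , y') =
  ((b < x' × x' < x) ⊎ (x < x' × x' < a)) ⊎ ((d < y' × y' < y) ⊎ (y < y' × y' < c))

record ProperPinSeq {n : ℕ} (π : Permutation′ n) (m : ℕ) (p : ℕ → Point) : Set where
  field
    inPlot     : ∀ k → 1 ≤ k → k ≤ m → InPlot π (p k)
    distinct   : ∀ j k → 1 ≤ j → j ≤ m → 1 ≤ k → k ≤ m → j ≢ k → p j ≢ p k
    pin        : ∀ i → 3 ≤ i → i ≤ m → IsPin (R p (Data.Nat.pred i)) (p i)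
    maximal    : ∀ i → 3 ≤ i → i ≤ m → ∀ dir →
                 HasDir dir (R p (Data.Nat.pred i)) (p i) →
                 Extreme π dir (R p (Data.Nat.pred i)) (p i)
    separation : ∀ i → 2 ≤ i → suc i ≤ m →
                 Separates (R p (Data.Nat.pred i)) (p i) (p (suc i))

{-# OPTIONS --safe #-}
-- A pin p_i of direction d lies outside rect(p_1,…,p_{i-1}) along the axis of d, so it
-- slices that rectangle along the other axis.  Nothing can then separate p_i from the
-- rectangle along the other axis, so p_{i+1} separates them along the axis of d, which
-- puts p_{i+1} within rect(p_1,…,p_i) along that axis: p_{i+1} is a pin along the other
-- axis.
module Submission where

open import Defs
open import Data.Nat using (ℕ; suc; pred; _≤_; _<_; _⊓_; _⊔_; s≤s)
open import Data.Nat.Properties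
  using (≤-refl; ≤-trans; <-trans; <⇒≤; <⇒≱; <-asym; m⊓n≤m; m⊓n≤n; m≤m⊔n; m≤n⊔m)
open import Data.Fin.Permutation using (Permutation′)
open import Data.Product using (_×_; _,_; proj₁; proj₂)
open import Data.Sum using (_⊎_; inj₁; inj₂)
open import Data.Empty using (⊥-elim)
open import Relation.Nullary using (¬_)
open import Relation.Binary.PropositionalEquality using (_≡_; _≢_; refl; subst; sym)

data Axis : Set where
  horizontal vertical : Axis

perpendicular : Axis → Axis
perpendicular horizontal = vertical
perpendicular vertical   = horizontal

axis : Dir → Axis
axis left  = horizontal
axis right = horizontal
axis up    = vertical
axis down  = vertical

axis-opposite : ∀ dir → axis (opposite dir) ≡ axis dir
axis-opposite left  = refl
axis-opposite right = refl
axis-opposite up    = refl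
axis-opposite down  = refl

axis-≢⇒≢ : ∀ {dir dir′} → axis dir′ ≢ axis dir → (dir′ ≢ dir) × (dir′ ≢ opposite dir)
axis-≢⇒≢ {dir} ne = (λ { refl → ne refl }) , (λ { refl → ne (axis-opposite dir) })

coord : Axis → Point → ℕ
coord horizontal = proj₁
coord vertical   = proj₂

lower upper : Axis → Rect → ℕ
lower horizontal = a
lower vertical   = c
upper horizontal = b
upper vertical   = d

InsideAlong WithinAlong : Axis → Rect → Point → Set
InsideAlong ax r q = lower ax r < coord ax q × coord ax q < upper ax r
WithinAlong ax r q = lower ax r ≤ coord ax q × coord ax q ≤ upper ax r

SeparatesAlong : Axis → Rect → Point → Point → Set
SeparatesAlong ax r q q′ =
  (upper ax r < coord ax q′ × coord ax q′ < coord ax q) ⊎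
  (coord ax q < coord ax q′ × coord ax q′ < lower ax r)

-- Slices r q and Separates r q q′ unfold to P horizontal ⊎ P vertical with P = InsideAlong
-- and P = SeparatesAlong respectively.
along-perpendicular : ∀ {P : Axis → Set} ax → P horizontal ⊎ P vertical → ¬ P ax → P (perpendicular ax)
along-perpendicular horizontal (inj₁ p) ¬p = ⊥-elim (¬p p)
along-perpendicular horizontal (inj₂ p) ¬p = p
along-perpendicular vertical   (inj₁ p) ¬p = p
along-perpendicular vertical   (inj₂ p) ¬p = ⊥-elim (¬p p)

along-axis : ∀ {P : Axis → Set} ax → P horizontal ⊎ P vertical → ¬ P (perpendicular ax) → P ax
along-axis horizontal (inj₁ p) ¬p = p
along-axis horizontal (inj₂ p) ¬p = ⊥-elim (¬p p)
along-axis vertical   (inj₁ p) ¬p = ⊥-elim (¬p p)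
along-axis vertical   (inj₂ p) ¬p = p

inside⇒within : ∀ {ax r q} → InsideAlong ax r q → WithinAlong ax r q
inside⇒within (lo<x , x<hi) = <⇒≤ lo<x , <⇒≤ x<hi

hasDir⇒¬within : ∀ dir {r q} → HasDir dir r q → ¬ WithinAlong (axis dir) r q
hasDir⇒¬within left  x<a (a≤x , _)   = <⇒≱ x<a a≤x
hasDir⇒¬within right b<x (_   , x≤b) = <⇒≱ b<x x≤b
hasDir⇒¬within up    d<y (_   , y≤d) = <⇒≱ d<y y≤d
hasDir⇒¬within down  y<c (c≤y , _)   = <⇒≱ y<c c≤y

hasDir⇒¬inside : ∀ dir {r q} → HasDir dir r q → ¬ InsideAlong (axis dir) r q
hasDir⇒¬inside dir h inside = hasDir⇒¬within dir h (inside⇒within {axis dir} inside)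

inside⇒¬separates : ∀ {ax r q q′} → InsideAlong ax r q → ¬ SeparatesAlong ax r q q′
inside⇒¬separates (_ , x<hi) (inj₁ (hi<x′ , x′<x)) = <-asym x<hi (<-trans hi<x′ x′<x)
inside⇒¬separates (lo<x , _) (inj₂ (x<x′ , x′<lo)) = <-asym lo<x (<-trans x<x′ x′<lo)

WellFormed : Rect → Set
WellFormed r = ∀ ax → lower ax r ≤ upper ax r

pointRect-wellFormed : ∀ q → WellFormed (pointRect q)
pointRect-wellFormed q horizontal = ≤-refl
pointRect-wellFormed q vertical   = ≤-refl

⊓≤⊔ : ∀ {lo hi} x → lo ≤ hi → lo ⊓ x ≤ hi ⊔ x
⊓≤⊔ {lo} {hi} x lo≤hi = ≤-trans (m⊓n≤m lo x) (≤-trans lo≤hi (m≤m⊔n hi x))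

extend-wellFormed : ∀ {r} q → WellFormed r → WellFormed (extend r q)
extend-wellFormed q wf horizontal = ⊓≤⊔ (proj₁ q) (wf horizontal)
extend-wellFormed q wf vertical   = ⊓≤⊔ (proj₂ q) (wf vertical)

R-wellFormed : ∀ p k → WellFormed (R p k)
R-wellFormed p 0             = pointRect-wellFormed (p 1)
R-wellFormed p 1             = pointRect-wellFormed (p 1)
R-wellFormed p (suc (suc k)) = extend-wellFormed (p (suc (suc k))) (R-wellFormed p (suc k))

separator-within-⊓⊔ : ∀ {lo hi x x′} → lo ≤ hi →
                      (hi < x′ × x′ < x) ⊎ (x < x′ × x′ < lo) → lo ⊓ x ≤ x′ × x′ ≤ hi ⊔ x
separator-within-⊓⊔ {lo} {hi} {x} lo≤hi (inj₁ (hi<x′ , x′<x)) =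
  ≤-trans (m⊓n≤m lo x) (≤-trans lo≤hi (<⇒≤ hi<x′)) , ≤-trans (<⇒≤ x′<x) (m≤n⊔m hi x)
separator-within-⊓⊔ {lo} {hi} {x} lo≤hi (inj₂ (x<x′ , x′<lo)) =
  ≤-trans (m⊓n≤n lo x) (<⇒≤ x<x′) , ≤-trans (<⇒≤ x′<lo) (≤-trans lo≤hi (m≤m⊔n hi x))

separates⇒within-extend : ∀ ax {r q q′} → WellFormed r →
                          SeparatesAlong ax r q q′ → WithinAlong ax (extend r q) q′
separates⇒within-extend horizontal wf = separator-within-⊓⊔ (wf horizontal)
separates⇒within-extend vertical   wf = separator-within-⊓⊔ (wf vertical)

separating-pin-axis≢ : ∀ {r q q′} dir dir′ → WellFormed r → IsPin r q → Separates r q q′ →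
                       HasDir dir r q → HasDir dir′ (extend r q) q′ → axis dir′ ≢ axis dir
separating-pin-axis≢ {r} {q} {q′} dir dir′ wf (_ , slices) separates h h′ same =
  hasDir⇒¬within dir′ h′ (subst (λ ax → WithinAlong ax (extend r q) q′) (sym same) within)
  where
    slicesAcross : InsideAlong (perpendicular (axis dir)) r q
    slicesAcross = along-perpendicular {λ ax → InsideAlong ax r q} (axis dir) slices (hasDir⇒¬inside dir h)

    separatesAlong : SeparatesAlong (axis dir) r q q′
    separatesAlong = along-axis {λ ax → SeparatesAlong ax r q q′} (axis dir) separates
                                (inside⇒¬separates {perpendicular (axis dir)} slicesAcross)

    within : WithinAlong (axis dir) (extend r q) q′
    within = separates⇒within-extend (axis dir) wf separatesAlong

lemma3p1 : ∀ {n} (π : Permutation′ n) (m : ℕ) (p : ℕ → Point) →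
           ProperPinSeq π m p →
           ∀ i → 3 ≤ i → suc i ≤ m → ∀ d d' →
           HasDir d (R p (pred i)) (p i) →
           HasDir d' (R p i) (p (suc i)) →
           (d' ≢ d) × (d' ≢ opposite d)
-- Matching on 3 ≤ i exposes i = suc (suc _), so R p i unfolds to extend (R p (pred i)) (p i).
lemma3p1 π m p P i 3≤i@(s≤s (s≤s (s≤s _))) i<m dir dir′ h h′ =
  axis-≢⇒≢ (separating-pin-axis≢ dir dir′ (R-wellFormed p (pred i))
                                (ProperPinSeq.pin P i 3≤i (<⇒≤ i<m))
                                (ProperPinSeq.separation P i (<⇒≤ 3≤i) i<m)
                                h h′)
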